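{- Let $n,m$ be positive integers and $0\le r\le\min\{m,n\}$. Then \[SF_r=\sum_{d=0}^{r}\{SF_d-SF_{d-1}\}_{\lambda_1\le n+m-d-r},\] with the convention $SF_{ -1}=0$.
   Context: $\Lambda$ is the ring of symmetric functions over $\mathbb{C}(q)$, $s_\mu$ Schur functions, $h_k$ complete homogeneous symmetric functions. For $0\le d\le\min\{m,n\}$, $SF_d=\sum_{\mu\vdash d}(s_\mu h_{n-d})\otimes(s_\mu h_{m-d})\in\Lambda\otimes_{\mathbb{C}(q)}\Lambda$. For $F=\sum c_{\lambda,\mu}s_\lambda\otimes s_\mu$ and an integer $L$, $\{F\}_{\lambda_1\le L}=\sum c_{\lambda,\mu}s_\lambda\otimes s_\mu$ summed only over pairs with both $\lambda_1\le L$ and $\mu_1\le L$. -}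

module Defs where

open import Data.Nat using (ℕ; zero; suc; _+_; _∸_; _≤_; _<_; _≥_; _≤ᵇ_; _≡ᵇ_)
open import Data.Integer as ℤ using (ℤ; +_; _-_)
open import Data.Bool using (Bool; true; false; _∧_; if_then_else_)
open import Data.List using (List; []; _∷_; _++_; map; length)
open import Data.Nat.ListAction using (sum)
open import Data.List.Relation.Unary.All using (All)
open import Data.List.Relation.Unary.Linked using (Linked)
open import Data.Product using (Σ; _×_; proj₁)

IsPartition : List ℕ → Set
IsPartition xs = Linked _≥_ xs × All (0 <_) xs

Partition : Set
Partition = Σ (List ℕ) IsPartition

size : List ℕ → ℕ
size = sum

hd : List ℕ → ℕ
hd []      = 0
hd (x ∷ _) = x

tl : List ℕ → List ℕ
tl []       = []
tl (_ ∷ xs) = xs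

lam₁ : Partition → ℕ
lam₁ p = hd (proj₁ p)

-- All partitions of d (as lists), parts bounded by k; fuel f ≥ d.
partsBounded : ℕ → ℕ → ℕ → List (List ℕ)
partsBounded fuel k zero = [] ∷ []
partsBounded zero k (suc d) = []
partsBounded (suc fuel) k (suc d) = go k
  where
  go : ℕ → List (List ℕ)
  go zero = []
  go (suc i) = go i ++
    (if suc i ≤ᵇ suc d
     then map (suc i ∷_) (partsBounded fuel (suc i) (suc d ∸ suc i))
     else [])

partitionsOf : ℕ → List (List ℕ)
partitionsOf d = partsBounded d d d

-- Horizontal strips: λ/μ is a horizontal strip iff μ ⊆ λ and the parts
-- interlace: λ₁ ≥ μ₁ ≥ λ₂ ≥ μ₂ ≥ … (lists padded with zeros).

hstrip : List ℕ → List ℕ → Bool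
hstrip [] [] = true
hstrip [] (m ∷ ms) = (m ≤ᵇ 0) ∧ hstrip [] ms
hstrip (l ∷ ls) ms = (hd ms ≤ᵇ l) ∧ ((hd ls ≤ᵇ hd ms) ∧ hstrip ls (tl ms))

-- Elements of Λ and Λ ⊗ Λ, represented by their coefficients in the
-- Schur basis {s_λ} resp. {s_λ ⊗ s_μ}.  (All coefficients occurring
-- here are integers, which embed in ℂ(q).)

Sym : Set
Sym = Partition → ℤ

Sym⊗Sym : Set
Sym⊗Sym = Partition → Partition → ℤ

_⊗_ : Sym → Sym → Sym⊗Sym
(f ⊗ g) la ν = f la ℤ.* g ν

_⊕_ : Sym⊗Sym → Sym⊗Sym → Sym⊗Sym
(F ⊕ G) la ν = F la ν ℤ.+ G la ν

_⊖_ : Sym⊗Sym → Sym⊗Sym → Sym⊗Sym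
(F ⊖ G) la ν = F la ν - G la ν

zero⊗ : Sym⊗Sym
zero⊗ _ _ = + 0

-- s_μ h_k, expanded in the Schur basis by the Pieri rule:
-- s_μ h_k = Σ_{λ : λ/μ horizontal strip, |λ| = |μ| + k} s_λ.
schurTimesH : List ℕ → ℕ → Sym
schurTimesH μ k la =
  if hstrip (proj₁ la) μ ∧ (size (proj₁ la) ≡ᵇ size μ + k) then + 1 else + 0

sumList : {A : Set} → (A → Sym⊗Sym) → List A → Sym⊗Sym
sumList f []       = zero⊗
sumList f (x ∷ xs) = f x ⊕ sumList f xs

SF : (n m d : ℕ) → Sym⊗Sym
SF n m d = sumList (λ μ → schurTimesH μ (n ∸ d) ⊗ schurTimesH μ (m ∸ d)) (partitionsOf d)

ΔSF : (n m d : ℕ) → Sym⊗Sym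
ΔSF n m zero    = SF n m zero
ΔSF n m (suc d) = SF n m (suc d) ⊖ SF n m d

truncate : ℕ → Sym⊗Sym → Sym⊗Sym
truncate L F la ν = if (lam₁ la ≤ᵇ L) ∧ (lam₁ ν ≤ᵇ L) then F la ν else + 0

sumTo : ℕ → (ℕ → Sym⊗Sym) → Sym⊗Sym
sumTo zero    f = f zero
sumTo (suc r) f = sumTo r f ⊕ f (suc r)

-- By the Pieri rule, the coefficient of s_λ ⊗ s_ν in SF_d (for |λ| = n, |ν| = m) counts the
-- partitions μ ⊢ d for which λ/μ and ν/μ are both horizontal strips, i.e. the lattice points of
-- total d in the box ∏ᵢ [max(λᵢ₊₁, νᵢ₊₁), min(λᵢ, νᵢ)].  Reflecting every coordinate inside its
-- interval shows that this count B(d) satisfies B(d) = B(S − d), where S is the sum of all interval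
-- endpoints, and B(d) = 0 for d > S.  Since S + max(λ₁, ν₁) = n + m, the truncation condition on the
-- d-th summand says exactly d + r ≤ S, so the right-hand side telescopes to B(min(r, S − r)) when
-- r ≤ S and to 0 otherwise; in both cases this is B(r).

module Submission where

open import Defs
open import Algebra.Bundles using (CommutativeMonoid)
open import Data.Bool using (Bool; true; false; _∧_; if_then_else_)
open import Data.Bool.Properties
  using (∧-assoc; ∧-comm; ∧-zeroʳ; ∧-conicalˡ; ∧-conicalʳ; ∧-commutativeMonoid; T-≡)
open import Algebra.Properties.CommutativeSemigroup
  (CommutativeMonoid.commutativeSemigroup ∧-commutativeMonoid) using (interchange)
open import Data.Integer as ℤ using (ℤ; +_; -[1+_]; _-_)
open import Data.Integer.Properties using ([+m]-[+n]≡m⊖n; ⊖-<; ⊖-≥; pos-+)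
import Data.Integer.Properties as ℤ
open import Data.Integer.Tactic.RingSolver using (solve-∀)
import Data.Nat.Tactic.RingSolver as ℕ-Ring
open import Data.List using (List; []; _∷_; _++_; map)
open import Data.List.Relation.Unary.All as All using (All; []; _∷_)
open import Data.List.Relation.Unary.All.Properties using (++⁺; map⁺)
open import Data.Nat
open import Data.Nat.Properties
open import Data.Product using (_×_; _,_; proj₁)
open import Data.Sum using (inj₁; inj₂)
open import Function.Bundles using (Equivalence; mk⇔)
open import Relation.Binary.PropositionalEquality
open import Relation.Nullary using (yes; no; _×-dec_; contradiction)
open import Relation.Nullary.Decidable using (dec-true; dec-false; does-⇔)

open ≡-Reasoning

≤ᵇ-true : ∀ {m n} → m ≤ n → (m ≤ᵇ n) ≡ true
≤ᵇ-true {m} {n} = dec-true (m ≤? n)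

≤ᵇ-false : ∀ {m n} → m ≰ n → (m ≤ᵇ n) ≡ false
≤ᵇ-false {m} {n} = dec-false (m ≤? n)

≤ᵇ-true⁻¹ : ∀ {m n} → (m ≤ᵇ n) ≡ true → m ≤ n
≤ᵇ-true⁻¹ {m} {n} eq = ≤ᵇ⇒≤ m n (Equivalence.from T-≡ eq)

if-same : ∀ {A : Set} c {x : A} → (if c then x else x) ≡ x
if-same true  = refl
if-same false = refl

if-then-cong : ∀ c {x y : ℕ} → (c ≡ true → x ≡ y) → (if c then x else 0) ≡ (if c then y else 0)
if-then-cong true  eq = eq refl
if-then-cong false _  = refl

⊔-≤ᵇ : ∀ u v x → (u ≤ᵇ x) ∧ (v ≤ᵇ x) ≡ (u ⊔ v ≤ᵇ x)
⊔-≤ᵇ u v x = does-⇔ (mk⇔ (λ (u≤x , v≤x) → ⊔-lub u≤x v≤x)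
                           (λ u⊔v≤x → m⊔n≤o⇒m≤o u v u⊔v≤x , m⊔n≤o⇒n≤o u v u⊔v≤x))
                      ((u ≤? x) ×-dec (v ≤? x)) (u ⊔ v ≤? x)

between-∧ : ∀ x u v u′ v′ →
  ((x ≤ᵇ u) ∧ (v ≤ᵇ x)) ∧ ((x ≤ᵇ u′) ∧ (v′ ≤ᵇ x)) ≡ (v ⊔ v′ ≤ᵇ x) ∧ (x ≤ᵇ u ⊓ u′)
between-∧ x u v u′ v′ = does-⇔ (mk⇔ to from)
  (((x ≤? u) ×-dec (v ≤? x)) ×-dec ((x ≤? u′) ×-dec (v′ ≤? x)))
  ((v ⊔ v′ ≤? x) ×-dec (x ≤? u ⊓ u′))
  where
  to : (x ≤ u × v ≤ x) × (x ≤ u′ × v′ ≤ x) → v ⊔ v′ ≤ x × x ≤ u ⊓ u′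
  to ((x≤u , v≤x) , (x≤u′ , v′≤x)) = ⊔-lub v≤x v′≤x , ⊓-glb x≤u x≤u′
  from : v ⊔ v′ ≤ x × x ≤ u ⊓ u′ → (x ≤ u × v ≤ x) × (x ≤ u′ × v′ ≤ x)
  from (v⊔v′≤x , x≤u⊓u′) = (m≤n⊓o⇒m≤n u u′ x≤u⊓u′ , m⊔n≤o⇒m≤o v v′ v⊔v′≤x)
                          , (m≤n⊓o⇒m≤o u u′ x≤u⊓u′ , m⊔n≤o⇒n≤o v v′ v⊔v′≤x)

+-≤ᵇ-∸ : ∀ d {r S} → r ≤ S → (d + r ≤ᵇ S) ≡ (d ≤ᵇ S ∸ r)
+-≤ᵇ-∸ d {r} {S} r≤S =
  does-⇔ (mk⇔ (m+n≤o⇒m≤o∸n d) (m≤o∸n⇒m+n≤o d r≤S)) (d + r ≤? S) (d ≤? S ∸ r)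

≤ᵇ-∸-∸ : ∀ {M S T} d r → M + S ≡ T → d + r ≤ T → (M ≤ᵇ T ∸ d ∸ r) ≡ (d + r ≤ᵇ S)
≤ᵇ-∸-∸ {M} {S} {T} d r M+S≡T d+r≤T = does-⇔ (mk⇔ to from) (M ≤? T ∸ d ∸ r) (d + r ≤? S)
  where
  to : M ≤ T ∸ d ∸ r → d + r ≤ S
  to M≤ = +-cancelˡ-≤ M (d + r) S (subst (M + (d + r) ≤_) (sym M+S≡T)
            (m≤o∸n⇒m+n≤o M d+r≤T (subst (M ≤_) (∸-+-assoc T d r) M≤)))
  from : d + r ≤ S → M ≤ T ∸ d ∸ r
  from d+r≤S = subst (M ≤_) (sym (∸-+-assoc T d r))
                 (m+n≤o⇒m≤o∸n M (subst (M + (d + r) ≤_) M+S≡T (+-monoʳ-≤ M d+r≤S)))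

⊓-+-⊔ : ∀ x y → x ⊓ y + (x ⊔ y) ≡ x + y
⊓-+-⊔ x y with ≤-total x y
... | inj₁ x≤y rewrite m≤n⇒m⊓n≡m x≤y | m≤n⇒m⊔n≡n x≤y = refl
... | inj₂ y≤x rewrite m≥n⇒m⊓n≡n y≤x | m≥n⇒m⊔n≡m y≤x = +-comm y x

-- Finite sums

∑< : ℕ → (ℕ → ℕ) → ℕ
∑< zero    f = 0
∑< (suc k) f = ∑< k f + f k

syntax ∑< k (λ j → e) = ∑[ j < k ] e

∑-cong : ∀ k {f g : ℕ → ℕ} → (∀ j → j < k → f j ≡ g j) → ∑< k f ≡ ∑< k g
∑-cong zero    _  = refl
∑-cong (suc k) eq = cong₂ _+_ (∑-cong k (λ j j<k → eq j (m<n⇒m<1+n j<k))) (eq k ≤-refl)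

∑-zero : ∀ k {f : ℕ → ℕ} → (∀ j → j < k → f j ≡ 0) → ∑< k f ≡ 0
∑-zero zero    _  = refl
∑-zero (suc k) eq = cong₂ _+_ (∑-zero k (λ j j<k → eq j (m<n⇒m<1+n j<k))) (eq k ≤-refl)

∑-suc : ∀ k (f : ℕ → ℕ) → ∑< (suc k) f ≡ f 0 + ∑[ j < k ] f (suc j)
∑-suc zero    f = +-comm 0 (f 0)
∑-suc (suc k) f = trans (cong (_+ f (suc k)) (∑-suc k f)) (+-assoc (f 0) _ _)

∑-+ : ∀ a k (f : ℕ → ℕ) → ∑< (a + k) f ≡ ∑< a f + ∑[ j < k ] f (a + j)
∑-+ a zero    f = trans (cong (λ t → ∑< t f) (+-identityʳ a)) (sym (+-identityʳ _))
∑-+ a (suc k) f = begin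
  ∑< (a + suc k) f                              ≡⟨ cong (λ t → ∑< t f) (+-suc a k) ⟩
  ∑< (a + k) f + f (a + k)                      ≡⟨ cong (_+ f (a + k)) (∑-+ a k f) ⟩
  ∑< a f + ∑[ j < k ] f (a + j) + f (a + k)     ≡⟨ +-assoc (∑< a f) _ _ ⟩
  ∑< a f + ∑[ j < suc k ] f (a + j)             ∎

∑-reverse : ∀ k (f : ℕ → ℕ) → ∑[ j < k ] f (k ∸ suc j) ≡ ∑< k f
∑-reverse zero    f = refl
∑-reverse (suc k) f = begin
  ∑[ j < suc k ] f (k ∸ j)           ≡⟨ ∑-suc k (λ j → f (k ∸ j)) ⟩
  f k + ∑[ j < k ] f (k ∸ suc j)     ≡⟨ cong (λ t → f k + t) (∑-reverse k f) ⟩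
  f k + ∑< k f                       ≡⟨ +-comm (f k) _ ⟩
  ∑< (suc k) f                       ∎

∑-vanishing-tail : ∀ {M N} (f : ℕ → ℕ) → M ≤ N → (∀ x → M ≤ x → f x ≡ 0) → ∑< N f ≡ ∑< M f
∑-vanishing-tail {N = zero} f z≤n _ = refl
∑-vanishing-tail {M} {suc N} f M≤1+N vanish with M ≤? N
... | yes M≤N = trans (cong₂ _+_ (∑-vanishing-tail f M≤N vanish) (vanish N M≤N)) (+-identityʳ _)
... | no  M≰N = cong (λ t → ∑< t f) (sym (≤-antisym M≤1+N (≰⇒> M≰N)))

-- Lattice points in a box

boxCount : List (ℕ × ℕ) → ℤ → ℕ
boxCount []             (+ zero) = 1
boxCount []             _        = 0
boxCount ((a , b) ∷ bs) z        = ∑[ j < suc b ∸ a ] boxCount bs (z - + (a + j))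

endpointSum : List (ℕ × ℕ) → ℕ
endpointSum []             = 0
endpointSum ((a , b) ∷ bs) = a + b + endpointSum bs

lowerEndsZero : List (ℕ × ℕ) → Bool
lowerEndsZero []             = true
lowerEndsZero ((a , _) ∷ bs) = (a ≤ᵇ 0) ∧ lowerEndsZero bs

inInterval : ℕ × ℕ → ℕ → Bool
inInterval (a , b) x = (a ≤ᵇ x) ∧ (x ≤ᵇ b)

boxSlice : ℕ × ℕ → List (ℕ × ℕ) → ℤ → ℕ → ℕ
boxSlice I bs z x = if inInterval I x then boxCount bs (z - + x) else 0

-[1+]-+ : ∀ k n → -[1+ k ] - + n ≡ -[1+ (k + n) ]
-[1+]-+ k zero    = cong -[1+_] (sym (+-identityʳ k))
-[1+]-+ k (suc n) = cong -[1+_] (sym (+-suc k n))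

[+m]-[+n]-< : ∀ {m n} → m < n → + m - + n ≡ -[1+ (n ∸ suc m) ]
[+m]-[+n]-< {m} {n} m<n =
  trans ([+m]-[+n]≡m⊖n m n) (trans (⊖-< m<n) (cong (λ t → ℤ.- + t) (+-∸-assoc 1 m<n)))

[+m]-[+n]-≥ : ∀ {m n} → n ≤ m → + m - + n ≡ + (m ∸ n)
[+m]-[+n]-≥ {m} {n} n≤m = trans ([+m]-[+n]≡m⊖n m n) (⊖-≥ n≤m)

boxCount-neg : ∀ bs k → boxCount bs -[1+ k ] ≡ 0
boxCount-neg []             k = refl
boxCount-neg ((a , b) ∷ bs) k = ∑-zero (suc b ∸ a) λ j _ →
  trans (cong (boxCount bs) (-[1+]-+ k (a + j))) (boxCount-neg bs (k + (a + j)))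

boxCount-< : ∀ bs {m n} → m < n → boxCount bs (+ m - + n) ≡ 0
boxCount-< bs {m} {n} m<n = trans (cong (boxCount bs) ([+m]-[+n]-< m<n)) (boxCount-neg bs _)

boxCount-at-0 : ∀ bs → boxCount bs (+ 0) ≡ (if lowerEndsZero bs then 1 else 0)
boxCount-at-0 []                   = refl
boxCount-at-0 ((zero , b) ∷ bs)    = begin
  ∑[ j < suc b ] boxCount bs (+ 0 - + j)
    ≡⟨ ∑-suc b _ ⟩
  boxCount bs (+ 0) + ∑[ j < b ] boxCount bs -[1+ j ]
    ≡⟨ cong (λ t → boxCount bs (+ 0) + t) (∑-zero b (λ j _ → boxCount-neg bs j)) ⟩
  boxCount bs (+ 0) + 0
    ≡⟨ +-identityʳ _ ⟩
  boxCount bs (+ 0)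
    ≡⟨ boxCount-at-0 bs ⟩
  (if lowerEndsZero bs then 1 else 0) ∎
boxCount-at-0 ((suc a , b) ∷ bs) = ∑-zero (b ∸ a) (λ j _ → boxCount-neg bs (a + j))

reflect-offset : ∀ a b j → j < suc b ∸ a → a + (suc b ∸ a ∸ suc j) + j ≡ b
reflect-offset a b j j<K = suc-injective (begin
  suc (a + (K ∸ suc j) + j)   ≡⟨ sym (+-suc _ j) ⟩
  a + (K ∸ suc j) + suc j     ≡⟨ +-assoc a _ _ ⟩
  a + (K ∸ suc j + suc j)     ≡⟨ cong (λ t → a + t) (m∸n+n≡m j<K) ⟩
  a + K                       ≡⟨ m+[n∸m]≡n {a} (<⇒≤ (m∸n≢0⇒n<m (m<n⇒n≢0 j<K))) ⟩
  suc b                       ∎)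
  where K = suc b ∸ a

reflect-shift : ∀ a q j S z → + S - (z - + q) ≡ (+ (a + (q + j) + S) - z) - + (a + j)
reflect-shift a q j S z = begin
  + S - (z - + q)
    ≡⟨ ring (+ a) (+ q) (+ j) (+ S) z ⟩
  ((+ a ℤ.+ (+ q ℤ.+ + j)) ℤ.+ + S - z) - (+ a ℤ.+ + j)
    ≡⟨ cong₂ (λ s t → (s - z) - t) (sym homo) (sym (pos-+ a j)) ⟩
  (+ (a + (q + j) + S) - z) - + (a + j) ∎
  where
  ring : ∀ (a q j S z : ℤ) → S - (z - q) ≡ ((a ℤ.+ (q ℤ.+ j)) ℤ.+ S - z) - (a ℤ.+ j)
  ring = solve-∀
  homo : + (a + (q + j) + S) ≡ (+ a ℤ.+ (+ q ℤ.+ + j)) ℤ.+ + S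
  homo = trans (pos-+ _ S) (cong (λ t → t ℤ.+ + S) (trans (pos-+ a _) (cong (λ t → + a ℤ.+ t) (pos-+ q j))))

-- x ↦ a + b − x maps [a, b] onto itself, coordinatewise
boxCount-reflect : ∀ bs z → boxCount bs z ≡ boxCount bs (+ endpointSum bs - z)
boxCount-reflect []             (+ zero)    = refl
boxCount-reflect []             (+ (suc _)) = refl
boxCount-reflect []             -[1+ _ ]    = refl
boxCount-reflect ((a , b) ∷ bs) z = begin
  ∑[ j < K ] boxCount bs (z - + (a + j))
    ≡⟨ ∑-cong K (λ j _ → boxCount-reflect bs _) ⟩
  ∑[ j < K ] boxCount bs (+ S - (z - + (a + j)))
    ≡⟨ sym (∑-reverse K _) ⟩
  ∑[ j < K ] boxCount bs (+ S - (z - + (a + (K ∸ suc j))))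
    ≡⟨ ∑-cong K (λ j j<K → cong (boxCount bs) (reflected j j<K)) ⟩
  ∑[ j < K ] boxCount bs ((+ (a + b + S) - z) - + (a + j)) ∎
  where
  K S : ℕ
  K = suc b ∸ a
  S = endpointSum bs
  reflected : ∀ j → j < K → + S - (z - + (a + (K ∸ suc j))) ≡ (+ (a + b + S) - z) - + (a + j)
  reflected j j<K = trans (reflect-shift a _ j S z)
    (cong (λ t → (+ (a + t + S) - z) - + (a + j)) (reflect-offset a b j j<K))

boxCount-reflectℕ : ∀ bs {z} → z ≤ endpointSum bs →
  boxCount bs (+ z) ≡ boxCount bs (+ (endpointSum bs ∸ z))
boxCount-reflectℕ bs z≤S = trans (boxCount-reflect bs _) (cong (boxCount bs) ([+m]-[+n]-≥ z≤S))

boxCount-> : ∀ bs {z} → endpointSum bs < z → boxCount bs (+ z) ≡ 0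
boxCount-> bs S<z = trans (boxCount-reflect bs _) (boxCount-< bs S<z)

∑-interval : ∀ a b (h : ℕ → ℕ) →
  ∑[ x < suc b ] (if inInterval (a , b) x then h x else 0) ≡ ∑[ j < suc b ∸ a ] h (a + j)
∑-interval a b h with a ≤? suc b
... | yes a≤1+b = begin
  ∑< (suc b) ψ                                  ≡⟨ cong (λ t → ∑< t ψ) (sym (m+[n∸m]≡n a≤1+b)) ⟩
  ∑< (a + (suc b ∸ a)) ψ                        ≡⟨ ∑-+ a (suc b ∸ a) ψ ⟩
  ∑< a ψ + ∑[ j < suc b ∸ a ] ψ (a + j)         ≡⟨ cong₂ _+_ (∑-zero a below) (∑-cong (suc b ∸ a) inside) ⟩
  ∑[ j < suc b ∸ a ] h (a + j)                  ∎
  where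
  ψ : ℕ → ℕ
  ψ x = if inInterval (a , b) x then h x else 0
  below : ∀ x → x < a → ψ x ≡ 0
  below x x<a = cong (λ c → if c ∧ (x ≤ᵇ b) then h x else 0) (≤ᵇ-false (<⇒≱ x<a))
  inside : ∀ j → j < suc b ∸ a → ψ (a + j) ≡ h (a + j)
  inside j j<K = cong₂ (λ c c′ → if c ∧ c′ then h (a + j) else 0) (≤ᵇ-true (m≤m+n a j))
    (≤ᵇ-true (≤-pred (≤-trans (+-monoʳ-< a j<K) (≤-reflexive (m+[n∸m]≡n a≤1+b)))))
... | no a≰1+b rewrite m≤n⇒m∸n≡0 (<⇒≤ (≰⇒> a≰1+b)) = ∑-zero (suc b) λ x x<1+b →
  cong (λ c → if c ∧ (x ≤ᵇ b) then h x else 0) (≤ᵇ-false (λ a≤x → a≰1+b (≤-trans a≤x (<⇒≤ x<1+b))))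

boxSlice-vanishes : ∀ a b bs {z x} → b ⊓ z < x → boxSlice (a , b) bs (+ z) x ≡ 0
boxSlice-vanishes a b bs {z} {x} b⊓z<x with x ≤? b
... | no x≰b = cong (λ c → if c then _ else 0)
                 (trans (cong ((a ≤ᵇ x) ∧_) (≤ᵇ-false x≰b)) (∧-zeroʳ (a ≤ᵇ x)))
... | yes x≤b = trans (cong (λ n → if inInterval (a , b) x then n else 0) (boxCount-< bs z<x))
                      (if-same (inInterval (a , b) x))
  where
  z<x : z < x
  z<x = ≰⇒> (λ x≤z → <⇒≱ b⊓z<x (⊓-glb x≤b x≤z))

∑-boxSlice : ∀ a b bs {z k} → b ⊓ z ≤ k →
  ∑[ x < suc k ] boxSlice (a , b) bs (+ z) x ≡ boxCount ((a , b) ∷ bs) (+ z)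
∑-boxSlice a b bs {z} {k} b⊓z≤k = begin
  ∑< (suc k) slice               ≡⟨ ∑-vanishing-tail slice (s≤s b⊓z≤k) vanish ⟩
  ∑< (suc (b ⊓ z)) slice         ≡⟨ sym (∑-vanishing-tail slice (s≤s (m⊓n≤m b z)) vanish) ⟩
  ∑< (suc b) slice               ≡⟨ ∑-interval a b _ ⟩
  boxCount ((a , b) ∷ bs) (+ z)  ∎
  where
  slice : ℕ → ℕ
  slice = boxSlice (a , b) bs (+ z)
  vanish : ∀ x → suc (b ⊓ z) ≤ x → slice x ≡ 0
  vanish _ = boxSlice-vanishes a b bs

-- Horizontal strips

hstrips : List ℕ → List ℕ → List ℕ → Bool
hstrips L N μ = hstrip L μ ∧ hstrip N μ

-- λ/μ and ν/μ are horizontal strips iff max(λᵢ₊₁, νᵢ₊₁) ≤ μᵢ ≤ min(λᵢ, νᵢ) for all i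
interval : List ℕ → List ℕ → ℕ × ℕ
interval L N = (hd (tl L) ⊔ hd (tl N) , hd L ⊓ hd N)

intervals : List ℕ → List ℕ → List (ℕ × ℕ)
intervals []       []       = []
intervals []       (y ∷ ys) = interval [] (y ∷ ys) ∷ intervals [] ys
intervals (x ∷ xs) N        = interval (x ∷ xs) N ∷ intervals xs (tl N)

boxCount-intervals : ∀ L N z →
  boxCount (intervals L N) z ≡ boxCount (interval L N ∷ intervals (tl L) (tl N)) z
boxCount-intervals []       []      z = sym (cong (boxCount []) (ℤ.+-identityʳ z))
boxCount-intervals []       (_ ∷ _) z = refl
boxCount-intervals (_ ∷ _)  N       z = refl

size-hd-tl : ∀ L → size L ≡ hd L + size (tl L)
size-hd-tl []      = refl
size-hd-tl (_ ∷ _) = refl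

endpointSum-step : ∀ L N →
  endpointSum (intervals (tl L) (tl N)) + (hd (tl L) ⊔ hd (tl N)) ≡ size (tl L) + size (tl N) →
  endpointSum (interval L N ∷ intervals (tl L) (tl N)) + (hd L ⊔ hd N) ≡ size L + size N
endpointSum-step L N tails = begin
  a + b + E + (hd L ⊔ hd N)
    ≡⟨ regroup a b E (hd L ⊔ hd N) ⟩
  (E + a) + (b + (hd L ⊔ hd N))
    ≡⟨ cong₂ _+_ tails (⊓-+-⊔ (hd L) (hd N)) ⟩
  (size (tl L) + size (tl N)) + (hd L + hd N)
    ≡⟨ regroup′ (size (tl L)) (size (tl N)) (hd L) (hd N) ⟩
  (hd L + size (tl L)) + (hd N + size (tl N))
    ≡⟨ sym (cong₂ _+_ (size-hd-tl L) (size-hd-tl N)) ⟩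
  size L + size N ∎
  where
  a b E : ℕ
  a = hd (tl L) ⊔ hd (tl N)
  b = hd L ⊓ hd N
  E = endpointSum (intervals (tl L) (tl N))
  regroup : ∀ a b E M → a + b + E + M ≡ (E + a) + (b + M)
  regroup = ℕ-Ring.solve-∀
  regroup′ : ∀ s t x y → (s + t) + (x + y) ≡ (x + s) + (y + t)
  regroup′ = ℕ-Ring.solve-∀

endpointSum-intervals : ∀ L N → endpointSum (intervals L N) + (hd L ⊔ hd N) ≡ size L + size N
endpointSum-intervals []       []       = refl
endpointSum-intervals []       (y ∷ ys) = endpointSum-step [] (y ∷ ys) (endpointSum-intervals [] ys)
endpointSum-intervals (x ∷ xs) N        = endpointSum-step (x ∷ xs) N (endpointSum-intervals xs (tl N))

hstrip-cons : ∀ L i μ → hstrip L (suc i ∷ μ) ≡ ((suc i ≤ᵇ hd L) ∧ (hd (tl L) ≤ᵇ suc i)) ∧ hstrip (tl L) μ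
hstrip-cons []       i μ = refl
hstrip-cons (y ∷ ys) i μ = sym (∧-assoc (suc i ≤ᵇ y) _ _)

hstrips-cons : ∀ L N i μ →
  hstrips L N (suc i ∷ μ) ≡ inInterval (interval L N) (suc i) ∧ hstrips (tl L) (tl N) μ
hstrips-cons L N i μ = begin
  hstrip L (suc i ∷ μ) ∧ hstrip N (suc i ∷ μ)
    ≡⟨ cong₂ _∧_ (hstrip-cons L i μ) (hstrip-cons N i μ) ⟩
  (inL ∧ hstrip (tl L) μ) ∧ (inN ∧ hstrip (tl N) μ)
    ≡⟨ interchange inL _ inN _ ⟩
  (inL ∧ inN) ∧ hstrips (tl L) (tl N) μ
    ≡⟨ cong (_∧ hstrips (tl L) (tl N) μ) (between-∧ (suc i) (hd L) (hd (tl L)) (hd N) (hd (tl N))) ⟩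
  inInterval (interval L N) (suc i) ∧ hstrips (tl L) (tl N) μ ∎
  where
  inL inN : Bool
  inL = (suc i ≤ᵇ hd L) ∧ (hd (tl L) ≤ᵇ suc i)
  inN = (suc i ≤ᵇ hd N) ∧ (hd (tl N) ≤ᵇ suc i)

hstrip-nil : ∀ L → hstrip L [] ≡ (hd (tl L) ≤ᵇ 0) ∧ hstrip (tl L) []
hstrip-nil []      = refl
hstrip-nil (_ ∷ _) = refl

hstrips-nil-step : ∀ L N → hstrips (tl L) (tl N) [] ≡ lowerEndsZero (intervals (tl L) (tl N)) →
  hstrips L N [] ≡ lowerEndsZero (interval L N ∷ intervals (tl L) (tl N))
hstrips-nil-step L N tails = begin
  hstrip L [] ∧ hstrip N []
    ≡⟨ cong₂ _∧_ (hstrip-nil L) (hstrip-nil N) ⟩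
  ((hd (tl L) ≤ᵇ 0) ∧ hstrip (tl L) []) ∧ ((hd (tl N) ≤ᵇ 0) ∧ hstrip (tl N) [])
    ≡⟨ interchange (hd (tl L) ≤ᵇ 0) _ _ _ ⟩
  ((hd (tl L) ≤ᵇ 0) ∧ (hd (tl N) ≤ᵇ 0)) ∧ hstrips (tl L) (tl N) []
    ≡⟨ cong₂ _∧_ (⊔-≤ᵇ (hd (tl L)) (hd (tl N)) 0) tails ⟩
  lowerEndsZero (interval L N ∷ intervals (tl L) (tl N)) ∎

hstrips-nil : ∀ L N → hstrips L N [] ≡ lowerEndsZero (intervals L N)
hstrips-nil []       []       = refl
hstrips-nil []       (y ∷ ys) = hstrips-nil-step [] (y ∷ ys) (hstrips-nil [] ys)
hstrips-nil (x ∷ xs) N        = hstrips-nil-step (x ∷ xs) N (hstrips-nil xs (tl N))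

All-tl : ∀ {P : ℕ → Set} {L} → All P L → All P (tl L)
All-tl []       = []
All-tl (_ ∷ ps) = ps

tl-empty : ∀ {L} → All (0 <_) L → hd (tl L) ≤ 0 → tl L ≡ []
tl-empty []                  _ = refl
tl-empty (_ ∷ [])            _ = refl
tl-empty (_ ∷ 0<x ∷ _) x≤0 = contradiction x≤0 (<⇒≱ 0<x)

-- Enumerating partitions

count : {A : Set} → (A → Bool) → List A → ℕ
count P []       = 0
count P (x ∷ xs) = if P x then suc (count P xs) else count P xs

count-++ : ∀ {A : Set} (P : A → Bool) xs ys → count P (xs ++ ys) ≡ count P xs + count P ys
count-++ P []       ys = refl
count-++ P (x ∷ xs) ys with P x
... | true  = cong suc (count-++ P xs ys)
... | false = count-++ P xs ys

count-map : ∀ {A B : Set} (P : B → Bool) (f : A → B) xs → count P (map f xs) ≡ count (λ x → P (f x)) xs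
count-map P f []       = refl
count-map P f (x ∷ xs) = cong (λ t → if P (f x) then suc t else t) (count-map P f xs)

count-∧ : ∀ {A : Set} c (P : A → Bool) xs → count (λ x → c ∧ P x) xs ≡ (if c then count P xs else 0)
count-∧ true  P xs       = refl
count-∧ false P []       = refl
count-∧ false P (_ ∷ xs) = count-∧ false P xs

count-cong : ∀ {A : Set} {P Q : A → Bool} {xs} → All (λ x → P x ≡ Q x) xs → count P xs ≡ count Q xs
count-cong []       = refl
count-cong (e ∷ es) = cong₂ (λ c t → if c then suc t else t) e (count-cong es)

partsWithHead : ℕ → ℕ → ℕ → List (List ℕ)
partsWithHead fuel i d =
  if suc i ≤ᵇ suc d then map (suc i ∷_) (partsBounded fuel (suc i) (suc d ∸ suc i)) else []

-- The enumeration local to partsBounded cannot be named.  Its lambda-lifted form is recovered as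
-- the solution of enumerate: abstracting suc k, and _++_ so that both sides are compared
-- argumentwise, turns the unification problem into a pattern.
private
  mutual
    enumerate : ℕ → ℕ → ℕ → ℕ → List (List ℕ)
    enumerate = _

    partsBounded-enumerate : ∀ f k d →
      partsBounded (suc f) (suc k) (suc d) ≡ enumerate f (suc k) d k ++ partsWithHead f k d
    partsBounded-enumerate f k d with suc k
    ... | _ with _++_ {A = List ℕ}
    ... | _ = refl

  enumerate-bound-irrelevant : ∀ f w w′ d i → enumerate f w d i ≡ enumerate f w′ d i
  enumerate-bound-irrelevant f w w′ d zero    = refl
  enumerate-bound-irrelevant f w w′ d (suc i) =
    cong (_++ partsWithHead f i d) (enumerate-bound-irrelevant f w w′ d i)

partsBounded-suc : ∀ f k d →
  partsBounded (suc f) (suc k) (suc d) ≡ partsBounded (suc f) k (suc d) ++ partsWithHead f k d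
partsBounded-suc f k d = trans (partsBounded-enumerate f k d)
  (cong (_++ partsWithHead f k d) (enumerate-bound-irrelevant f (suc k) k d k))

partsWithHead-≤ : ∀ f {i d} → suc i ≤ suc d →
  partsWithHead f i d ≡ map (suc i ∷_) (partsBounded f (suc i) (d ∸ i))
partsWithHead-≤ f {i} {d} i≤d =
  cong (λ c → if c then map (suc i ∷_) (partsBounded f (suc i) (d ∸ i)) else []) (≤ᵇ-true i≤d)

partsWithHead-> : ∀ f {i d} → suc i ≰ suc d → partsWithHead f i d ≡ []
partsWithHead-> f {i} {d} i≰d =
  cong (λ c → if c then map (suc i ∷_) (partsBounded f (suc i) (d ∸ i)) else []) (≤ᵇ-false i≰d)

count-partsBounded : ∀ (P : List ℕ → Bool) f k d →
  count P (partsBounded (suc f) k (suc d)) ≡ ∑[ i < k ] count P (partsWithHead f i d)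
count-partsBounded P f zero    d = refl
count-partsBounded P f (suc k) d = begin
  count P (partsBounded (suc f) (suc k) (suc d))
    ≡⟨ cong (count P) (partsBounded-suc f k d) ⟩
  count P (partsBounded (suc f) k (suc d) ++ partsWithHead f k d)
    ≡⟨ count-++ P (partsBounded (suc f) k (suc d)) _ ⟩
  count P (partsBounded (suc f) k (suc d)) + count P (partsWithHead f k d)
    ≡⟨ cong (_+ count P (partsWithHead f k d)) (count-partsBounded P f k d) ⟩
  ∑[ i < suc k ] count P (partsWithHead f i d) ∎

mutual
  partsBounded-size : ∀ fuel k d → All (λ μ → size μ ≡ d) (partsBounded fuel k d)
  partsBounded-size fuel    k       zero    = refl ∷ []
  partsBounded-size zero    k       (suc d) = []
  partsBounded-size (suc f) zero    (suc d) = []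
  partsBounded-size (suc f) (suc k) (suc d) = subst (All _) (sym (partsBounded-suc f k d))
    (++⁺ (partsBounded-size (suc f) k (suc d)) (partsWithHead-size f k d))

  partsWithHead-size : ∀ f i d → All (λ μ → size μ ≡ suc d) (partsWithHead f i d)
  partsWithHead-size f i d with suc i ≤? suc d
  ... | yes i≤d = subst (All _) (sym (partsWithHead-≤ f i≤d))
    (map⁺ (All.map (λ e → trans (cong (λ t → suc i + t) e) (m+[n∸m]≡n i≤d))
                   (partsBounded-size f (suc i) (d ∸ i))))
  ... | no  i≰d = subst (All _) (sym (partsWithHead-> f i≰d)) []

-- The coefficients of SF_d

boxSlice-0 : ∀ {L N} → All (0 <_) L → All (0 <_) N → ∀ d →
  boxSlice (interval L N) (intervals (tl L) (tl N)) (+ suc d) 0 ≡ 0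
boxSlice-0 {L} {N} L⁺ N⁺ d with hd (tl L) ⊔ hd (tl N) ≤? 0
... | no  a≰0 = cong (λ c → if c ∧ (0 ≤ᵇ hd L ⊓ hd N) then boxCount rest (+ suc d - + 0) else 0)
                     (≤ᵇ-false a≰0)
  where
  rest : List (ℕ × ℕ)
  rest = intervals (tl L) (tl N)
... | yes a≤0 = trans (cong (λ n → if inInterval (interval L N) 0 then n else 0) tails-empty) (if-same _)
  where
  tails-empty : boxCount (intervals (tl L) (tl N)) (+ suc d - + 0) ≡ 0
  tails-empty = cong₂ (λ L′ N′ → boxCount (intervals L′ N′) (+ suc d - + 0))
    (tl-empty L⁺ (m⊔n≤o⇒m≤o _ _ a≤0)) (tl-empty N⁺ (m⊔n≤o⇒n≤o _ _ a≤0))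

-- The bound k on the parts of μ cuts nothing off as long as k ≥ min(λ₁, ν₁, d).
mutual
  count-hstrips : ∀ fuel {L N} → All (0 <_) L → All (0 <_) N → ∀ k d → d ≤ fuel → hd L ⊓ hd N ⊓ d ≤ k →
    count (hstrips L N) (partsBounded fuel k d) ≡ boxCount (intervals L N) (+ d)
  count-hstrips _       {L} {N} _ _ _ zero _ _ =
    trans (cong (λ c → if c then 1 else 0) (hstrips-nil L N)) (sym (boxCount-at-0 (intervals L N)))
  count-hstrips (suc f) {L} {N} L⁺ N⁺ k (suc d) (s≤s d≤f) bound = begin
    count (hstrips L N) (partsBounded (suc f) k (suc d))
      ≡⟨ count-partsBounded (hstrips L N) f k d ⟩
    ∑[ i < k ] count (hstrips L N) (partsWithHead f i d)
      ≡⟨ ∑-cong k (λ i _ → count-partsWithHead f L⁺ N⁺ i d d≤f) ⟩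
    ∑[ i < k ] slice (suc i)
      ≡⟨ sym (trans (∑-suc k slice) (cong (_+ ∑[ i < k ] slice (suc i)) (boxSlice-0 L⁺ N⁺ d))) ⟩
    ∑< (suc k) slice
      ≡⟨ ∑-boxSlice (hd (tl L) ⊔ hd (tl N)) (hd L ⊓ hd N) rest bound ⟩
    boxCount (interval L N ∷ rest) (+ suc d)
      ≡⟨ sym (boxCount-intervals L N _) ⟩
    boxCount (intervals L N) (+ suc d) ∎
    where
    rest : List (ℕ × ℕ)
    rest = intervals (tl L) (tl N)
    slice : ℕ → ℕ
    slice = boxSlice (interval L N) rest (+ suc d)

  count-partsWithHead : ∀ f {L N} → All (0 <_) L → All (0 <_) N → ∀ i d → d ≤ f →
    count (hstrips L N) (partsWithHead f i d)
      ≡ boxSlice (interval L N) (intervals (tl L) (tl N)) (+ suc d) (suc i)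
  count-partsWithHead f {L} {N} L⁺ N⁺ i d d≤f with suc i ≤? suc d
  ... | no  i≰d = trans (cong (count (hstrips L N)) (partsWithHead-> f i≰d))
                        (sym (boxSlice-vanishes (hd (tl L) ⊔ hd (tl N)) (hd L ⊓ hd N) (intervals (tl L) (tl N))
                          (≤-<-trans (m⊓n≤n _ _) (≰⇒> i≰d))))
  ... | yes i≤d = begin
    count (hstrips L N) (partsWithHead f i d)
      ≡⟨ cong (count (hstrips L N)) (partsWithHead-≤ f i≤d) ⟩
    count (hstrips L N) (map (suc i ∷_) μs)
      ≡⟨ count-map (hstrips L N) (suc i ∷_) μs ⟩
    count (λ μ → hstrips L N (suc i ∷ μ)) μs
      ≡⟨ count-cong (All.universal (hstrips-cons L N i) μs) ⟩
    count (λ μ → c ∧ hstrips (tl L) (tl N) μ) μs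
      ≡⟨ count-∧ c _ μs ⟩
    (if c then count (hstrips (tl L) (tl N)) μs else 0)
      ≡⟨ if-then-cong c tails ⟩
    boxSlice (interval L N) (intervals (tl L) (tl N)) (+ suc d) (suc i) ∎
    where
    μs : List (List ℕ)
    μs = partsBounded f (suc i) (d ∸ i)
    c : Bool
    c = inInterval (interval L N) (suc i)
    tails : c ≡ true →
      count (hstrips (tl L) (tl N)) μs ≡ boxCount (intervals (tl L) (tl N)) (+ suc d - + suc i)
    tails c≡true = trans
      (count-hstrips f (All-tl L⁺) (All-tl N⁺) (suc i) (d ∸ i) (≤-trans (m∸n≤m d i) d≤f) bound)
      (cong (boxCount (intervals (tl L) (tl N))) (sym ([+m]-[+n]-≥ i≤d)))
      where
      bound : hd (tl L) ⊓ hd (tl N) ⊓ (d ∸ i) ≤ suc i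
      bound = ≤-trans (m⊓n≤m _ _) (≤-trans (m⊓n≤m⊔n _ _)
                (≤ᵇ-true⁻¹ (∧-conicalˡ _ _ c≡true)))

pieri : List ℕ → List ℕ → ℕ → Bool
pieri L μ k = hstrip L μ ∧ (size L ≡ᵇ size μ + k)

sumList-pieri : ∀ p q (la nu : Partition) xs →
  sumList (λ μ → schurTimesH μ p ⊗ schurTimesH μ q) xs la nu
    ≡ + count (λ μ → pieri (proj₁ la) μ p ∧ pieri (proj₁ nu) μ q) xs
sumList-pieri p q la nu []       = refl
sumList-pieri p q la nu (μ ∷ xs) with pieri (proj₁ la) μ p | pieri (proj₁ nu) μ q
... | true  | true  = cong (λ t → + 1 ℤ.+ t) (sumList-pieri p q la nu xs)
... | true  | false = cong (λ t → + 0 ℤ.+ t) (sumList-pieri p q la nu xs)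
... | false | _     = cong (λ t → + 0 ℤ.+ t) (sumList-pieri p q la nu xs)

sizesAre : ℕ → ℕ → List ℕ → List ℕ → Bool
sizesAre n m L N = (size L ≡ᵇ n) ∧ (size N ≡ᵇ m)

boxCoefficient : ℕ → ℕ → List ℕ → List ℕ → ℕ → ℕ
boxCoefficient n m L N d = if sizesAre n m L N then boxCount (intervals L N) (+ d) else 0

SF-coefficient : ∀ {n m d} → d ≤ n → d ≤ m → (la nu : Partition) →
  SF n m d la nu ≡ + boxCoefficient n m (proj₁ la) (proj₁ nu) d
SF-coefficient {n} {m} {d} d≤n d≤m la@(L , _ , L⁺) nu@(N , _ , N⁺) = begin
  SF n m d la nu
    ≡⟨ sumList-pieri (n ∸ d) (m ∸ d) la nu (partitionsOf d) ⟩
  + count (λ μ → pieri L μ (n ∸ d) ∧ pieri N μ (m ∸ d)) (partitionsOf d)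
    ≡⟨ cong +_ (count-cong (All.map pieri-sizes (partsBounded-size d d d))) ⟩
  + count (λ μ → sizesAre n m L N ∧ hstrips L N μ) (partitionsOf d)
    ≡⟨ cong +_ (count-∧ (sizesAre n m L N) (hstrips L N) (partitionsOf d)) ⟩
  + (if sizesAre n m L N then count (hstrips L N) (partitionsOf d) else 0)
    ≡⟨ cong (λ t → + (if sizesAre n m L N then t else 0)) (count-hstrips d L⁺ N⁺ d d ≤-refl (m⊓n≤n _ d)) ⟩
  + boxCoefficient n m L N d ∎
  where
  pieri-sizes : ∀ {μ} → size μ ≡ d →
    pieri L μ (n ∸ d) ∧ pieri N μ (m ∸ d) ≡ sizesAre n m L N ∧ hstrips L N μ
  pieri-sizes {μ} |μ|≡d rewrite |μ|≡d | m+[n∸m]≡n d≤n | m+[n∸m]≡n d≤m =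
    trans (interchange (hstrip L μ) _ _ _) (∧-comm (hstrips L N μ) _)

-- Telescoping

telescope : (ℕ → Bool) → (ℕ → ℤ) → ℕ → ℤ
telescope c f zero    = if c 0 then f 0 else + 0
telescope c f (suc r) = telescope c f r ℤ.+ (if c (suc r) then f (suc r) - f r else + 0)

sumTo-truncate-ΔSF : ∀ n m (B : ℕ → ℕ) r (la nu : Partition) →
  sumTo r (λ d → truncate (B d) (ΔSF n m d)) la nu
    ≡ telescope (λ d → (lam₁ la ≤ᵇ B d) ∧ (lam₁ nu ≤ᵇ B d)) (λ d → SF n m d la nu) r
sumTo-truncate-ΔSF n m B zero    la nu = refl
sumTo-truncate-ΔSF n m B (suc r) la nu =
  cong (λ t → t ℤ.+ truncate (B (suc r)) (ΔSF n m (suc r)) la nu) (sumTo-truncate-ΔSF n m B r la nu)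

telescope-cong : ∀ r {c c′ : ℕ → Bool} {f f′ : ℕ → ℤ} →
  (∀ d → d ≤ r → c d ≡ c′ d) → (∀ d → d ≤ r → f d ≡ f′ d) → telescope c f r ≡ telescope c′ f′ r
telescope-cong zero    c≡ f≡ = cong₂ (λ b x → if b then x else + 0) (c≡ 0 z≤n) (f≡ 0 z≤n)
telescope-cong (suc r) c≡ f≡ = cong₂ ℤ._+_
  (telescope-cong r (λ d d≤r → c≡ d (m≤n⇒m≤1+n d≤r)) (λ d d≤r → f≡ d (m≤n⇒m≤1+n d≤r)))
  (cong₂ (λ b x → if b then x else + 0) (c≡ (suc r) ≤-refl)
         (cong₂ _-_ (f≡ (suc r) ≤-refl) (f≡ r (n≤1+n r))))

telescope-zero : ∀ c r → telescope c (λ _ → + 0) r ≡ + 0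
telescope-zero c zero    = if-same (c 0)
telescope-zero c (suc r) = cong₂ ℤ._+_ (telescope-zero c r) (if-same (c (suc r)))

telescope-false : ∀ f r → telescope (λ _ → false) f r ≡ + 0
telescope-false f zero    = refl
telescope-false f (suc r) = cong (λ t → t ℤ.+ + 0) (telescope-false f r)

telescope-≤ᵇ : ∀ t f r → telescope (λ d → d ≤ᵇ t) f r ≡ f (r ⊓ t)
telescope-≤ᵇ t f zero    = refl
telescope-≤ᵇ t f (suc r) with suc r ≤? t
... | yes r<t = begin
  telescope (λ d → d ≤ᵇ t) f r ℤ.+ (if suc r ≤ᵇ t then f (suc r) - f r else + 0)
    ≡⟨ cong₂ ℤ._+_ (trans (telescope-≤ᵇ t f r) (cong f (m≤n⇒m⊓n≡m (<⇒≤ r<t))))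
                   (cong (λ c → if c then f (suc r) - f r else + 0) (≤ᵇ-true r<t)) ⟩
  f r ℤ.+ (f (suc r) - f r)
    ≡⟨ cancel (f r) (f (suc r)) ⟩
  f (suc r)
    ≡⟨ cong f (sym (m≤n⇒m⊓n≡m r<t)) ⟩
  f (suc r ⊓ t) ∎
  where
  cancel : ∀ x y → x ℤ.+ (y - x) ≡ y
  cancel = solve-∀
... | no  r≮t = begin
  telescope (λ d → d ≤ᵇ t) f r ℤ.+ (if suc r ≤ᵇ t then f (suc r) - f r else + 0)
    ≡⟨ cong₂ ℤ._+_ (telescope-≤ᵇ t f r) (cong (λ c → if c then f (suc r) - f r else + 0) (≤ᵇ-false r≮t)) ⟩
  f (r ⊓ t) ℤ.+ + 0
    ≡⟨ ℤ.+-identityʳ _ ⟩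
  f (r ⊓ t)
    ≡⟨ cong f (trans (m≥n⇒m⊓n≡n t≤r) (sym (m≥n⇒m⊓n≡n (m≤n⇒m≤1+n t≤r)))) ⟩
  f (suc r ⊓ t) ∎
  where
  t≤r : t ≤ r
  t≤r = ≤-pred (≰⇒> r≮t)

boxCount-⊓-reflect : ∀ bs {r} → r ≤ endpointSum bs →
  boxCount bs (+ (r ⊓ (endpointSum bs ∸ r))) ≡ boxCount bs (+ r)
boxCount-⊓-reflect bs {r} r≤S with ≤-total r (endpointSum bs ∸ r)
... | inj₁ r≤S∸r = cong (λ x → boxCount bs (+ x)) (m≤n⇒m⊓n≡m r≤S∸r)
... | inj₂ S∸r≤r = begin
  boxCount bs (+ (r ⊓ (endpointSum bs ∸ r)))
    ≡⟨ cong (λ x → boxCount bs (+ x)) (m≥n⇒m⊓n≡n S∸r≤r) ⟩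
  boxCount bs (+ (endpointSum bs ∸ r))
    ≡⟨ boxCount-reflectℕ bs (m∸n≤m _ r) ⟩
  boxCount bs (+ (endpointSum bs ∸ (endpointSum bs ∸ r)))
    ≡⟨ cong (λ x → boxCount bs (+ x)) (m∸[m∸n]≡n r≤S) ⟩
  boxCount bs (+ r) ∎

boxCount-telescope : ∀ bs r →
  telescope (λ d → d + r ≤ᵇ endpointSum bs) (λ d → + boxCount bs (+ d)) r ≡ + boxCount bs (+ r)
boxCount-telescope bs r with r ≤? endpointSum bs
... | yes r≤S = begin
  telescope (λ d → d + r ≤ᵇ endpointSum bs) B r
    ≡⟨ telescope-cong r (λ d _ → +-≤ᵇ-∸ d r≤S) (λ _ _ → refl) ⟩
  telescope (λ d → d ≤ᵇ endpointSum bs ∸ r) B r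
    ≡⟨ telescope-≤ᵇ (endpointSum bs ∸ r) B r ⟩
  B (r ⊓ (endpointSum bs ∸ r))
    ≡⟨ cong +_ (boxCount-⊓-reflect bs r≤S) ⟩
  B r ∎
  where
  B : ℕ → ℤ
  B d = + boxCount bs (+ d)
... | no  r≰S = begin
  telescope (λ d → d + r ≤ᵇ endpointSum bs) (λ d → + boxCount bs (+ d)) r
    ≡⟨ telescope-cong r (λ d _ → ≤ᵇ-false (λ d+r≤S → r≰S (≤-trans (m≤n+m r d) d+r≤S))) (λ _ _ → refl) ⟩
  telescope (λ _ → false) (λ d → + boxCount bs (+ d)) r
    ≡⟨ telescope-false _ r ⟩
  + 0
    ≡⟨ cong +_ (sym (boxCount-> bs (≰⇒> r≰S))) ⟩
  + boxCount bs (+ r) ∎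

boxCoefficient-telescope : ∀ n m r L N → r ≤ n → r ≤ m →
  telescope (λ d → (hd L ≤ᵇ n + m ∸ d ∸ r) ∧ (hd N ≤ᵇ n + m ∸ d ∸ r)) (λ d → + boxCoefficient n m L N d) r
    ≡ + boxCoefficient n m L N r
boxCoefficient-telescope n m r L N r≤n r≤m with sizesAre n m L N in sizes
... | false = telescope-zero _ r
... | true  = trans (telescope-cong r truncation-condition (λ _ _ → refl))
                    (boxCount-telescope (intervals L N) r)
  where
  |L|≡n : size L ≡ n
  |L|≡n = ≡ᵇ⇒≡ _ _ (Equivalence.from T-≡ (∧-conicalˡ _ _ sizes))
  |N|≡m : size N ≡ m
  |N|≡m = ≡ᵇ⇒≡ _ _ (Equivalence.from T-≡ (∧-conicalʳ _ _ sizes))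
  M+S≡n+m : hd L ⊔ hd N + endpointSum (intervals L N) ≡ n + m
  M+S≡n+m = trans (+-comm (hd L ⊔ hd N) _) (trans (endpointSum-intervals L N) (cong₂ _+_ |L|≡n |N|≡m))
  truncation-condition : ∀ d → d ≤ r →
    (hd L ≤ᵇ n + m ∸ d ∸ r) ∧ (hd N ≤ᵇ n + m ∸ d ∸ r) ≡ (d + r ≤ᵇ endpointSum (intervals L N))
  truncation-condition d d≤r = trans (⊔-≤ᵇ (hd L) (hd N) _)
    (≤ᵇ-∸-∸ d r M+S≡n+m (+-mono-≤ (≤-trans d≤r r≤n) r≤m))

corollary3p3 : (n m r : ℕ) → 0 < n → 0 < m → r ≤ n → r ≤ m →
    (λ' ν : Partition) →
      SF n m r λ' ν ≡ sumTo r (λ d → truncate (n + m ∸ d ∸ r) (ΔSF n m d)) λ' ν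
corollary3p3 n m r _ _ r≤n r≤m la nu = begin
  SF n m r la nu
    ≡⟨ SF-coefficient r≤n r≤m la nu ⟩
  + boxCoefficient n m L N r
    ≡⟨ sym (boxCoefficient-telescope n m r L N r≤n r≤m) ⟩
  telescope truncated (λ d → + boxCoefficient n m L N d) r
    ≡⟨ telescope-cong r (λ _ _ → refl)
         (λ d d≤r → sym (SF-coefficient (≤-trans d≤r r≤n) (≤-trans d≤r r≤m) la nu)) ⟩
  telescope truncated (λ d → SF n m d la nu) r
    ≡⟨ sym (sumTo-truncate-ΔSF n m (λ d → n + m ∸ d ∸ r) r la nu) ⟩
  sumTo r (λ d → truncate (n + m ∸ d ∸ r) (ΔSF n m d)) la nu ∎
  where
  L N : List ℕ
  L = proj₁ la
  N = proj₁ nu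
  truncated : ℕ → Bool
  truncated d = (lam₁ la ≤ᵇ n + m ∸ d ∸ r) ∧ (lam₁ nu ≤ᵇ n + m ∸ d ∸ r)
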